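{- Let $k$ and $l$ be natural numbers, let $\gamma$ and $\delta$ be real numbers, let $f$ be a positive real-valued function on pairs of nonnegative integers, and let $n=\lfloor f(k,l)\binom{k+l}{k}\rfloor$, and define $f^*(k,l)$ by $n=f^*(k,l)\binom{k+l}{k}$. Suppose that for $m=1$ and $m=2$ each of the inequalities \[ r(k+1-m,l+1)\le f(k-m,l)\binom{k-m+l}{k-m},\qquad r(k+1,l+1-m)\le f(k,l-m)\binom{k+l-m}{k},\] \[ \frac{f(k-m,l)}{f^*(k,l)}\le 1+m\gamma,\qquad \frac{f(k,l-m)}{f^*(k,l)}\le 1+m\delta \] holds. Then in any red/blue colouring of the edges of $K_n$ (with vertex set $V$) containing neither a red $K_{k+1}$ nor a blue $K_{l+1}$, the balanced function $g$ of the colouring around $p=\frac{k}{k+l}$ satisfies \[ -\frac{l\delta}{k+l}n\le \sum_{y\in V} g(x,y)\le \frac{k\gamma}{k+l}n \] for all $x\in V$, and \[ \sum_{y\in V} g(x,y)g(y,z)\le 2\frac{\max(k,l)}{(k+l)^2}(k\gamma+l\delta)n+1 \] for all $x,z\in V$ with $x\neq z$.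
   Context: For positive integers $k,l$, the Ramsey number $r(k,l)$ is the smallest natural number $n$ such that in every red/blue colouring of the edges of $K_n$ there is either a red $K_k$ or a blue $K_l$. Given a red/blue colouring of the edges of the complete graph on vertex set $V$ and a real $p$, the balanced function of the colouring around $p$ is $g:V\times V\to\mathbb{R}$, $g(x,y)=A(x,y)-p$, where $A(x,y)=1$ if $xy$ is a red edge and $A(x,y)=0$ otherwise (in particular $A(x,x)=0$). -}

module Defs where

open import Level using (0ℓ)
open import Data.Nat as ℕ using (ℕ; zero; suc)
open import Data.Integer as ℤ using (ℤ; +_; -[1+_])
open import Data.Bool using (Bool; true; false; if_then_else_)
open import Data.Fin using (Fin; zero; suc)
open import Data.Fin.Properties using (_≟_)
open import Data.Product using (Σ; _×_; ∃)
open import Data.Sum using (_⊎_)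
open import Function.Definitions using (Injective)
open import Relation.Nullary using (¬_; yes; no)
open import Relation.Binary.PropositionalEquality using (_≡_; _≢_)
open import Algebra.Structures using (IsCommutativeRing)
open import Relation.Binary.Structures using (IsTotalOrder)

-- The real numbers, axiomatised as a complete ordered field
-- (any structure satisfying these axioms is isomorphic to ℝ).
-- A floor function is included as data (it exists in ℝ).

embℕ : {R : Set} → R → R → (R → R → R) → ℕ → R
embℕ z o add zero    = z
embℕ z o add (suc n) = add (embℕ z o add n) o

embℤ : {R : Set} → R → R → (R → R → R) → (R → R) → ℤ → R
embℤ z o add neg (+ n)    = embℕ z o add n
embℤ z o add neg -[1+ n ] = neg (embℕ z o add (suc n))

record Reals : Set₁ where
  infixl 7 _*_ _/_
  infixl 6 _+_ _−_
  infix 4 _≤_ _<_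
  field
    R      : Set
    _+_    : R → R → R
    _*_    : R → R → R
    -_     : R → R
    0# 1#  : R
    _⁻¹    : R → R        -- total; value at 0 is unspecified
    _≤_    : R → R → Set
    isCommutativeRing : IsCommutativeRing _≡_ _+_ _*_ -_ 0# 1#
    isTotalOrder      : IsTotalOrder _≡_ _≤_
    0≢1    : 0# ≢ 1#
    inverseʳ : ∀ x → x ≢ 0# → x * (x ⁻¹) ≡ 1#
    +-monoˡ-≤ : ∀ {x y} z → x ≤ y → x + z ≤ y + z
    *-nonneg  : ∀ {x y} → 0# ≤ x → 0# ≤ y → 0# ≤ x * y
    sup-exists : (P : R → Set) → (∃ λ x → P x) → (∃ λ b → ∀ x → P x → x ≤ b) →
                 ∃ λ s → (∀ x → P x → x ≤ s) × (∀ b → (∀ x → P x → x ≤ b) → s ≤ b)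

    ⌊_⌋      : R → ℤ
    floor-≤  : ∀ x → embℤ 0# 1# _+_ -_ ⌊ x ⌋ ≤ x
    floor-<  : ∀ x → (x ≤ embℤ 0# 1# _+_ -_ ⌊ x ⌋ + 1#) × (x ≢ embℤ 0# 1# _+_ -_ ⌊ x ⌋ + 1#)

  _−_ : R → R → R
  x − y = x + (- y)

  _<_ : R → R → Set
  x < y = (x ≤ y) × (x ≢ y)

  fromℕ : ℕ → R
  fromℕ = embℕ 0# 1# _+_

  fromℤ : ℤ → R
  fromℤ = embℤ 0# 1# _+_ -_

  _/_ : R → R → R
  x / y = x * (y ⁻¹)

  Σ[_] : (n : ℕ) → (Fin n → R) → R
  Σ[ zero ]  h = 0#
  Σ[ suc n ] h = h zero + Σ[ n ] (λ i → h (suc i))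

-- Red/blue colourings of K_N on vertex set Fin N (true = red).

record Colouring (N : ℕ) : Set where
  field
    colour : Fin N → Fin N → Bool
    symm   : ∀ x y → colour x y ≡ colour y x
open Colouring public

HasRedClique : ∀ {N} → ℕ → Colouring N → Set
HasRedClique {N} s c = Σ (Fin s → Fin N) λ h → Injective _≡_ _≡_ h ×
  (∀ i j → i ≢ j → colour c (h i) (h j) ≡ true)

HasBlueClique : ∀ {N} → ℕ → Colouring N → Set
HasBlueClique {N} s c = Σ (Fin s → Fin N) λ h → Injective _≡_ _≡_ h ×
  (∀ i j → i ≢ j → colour c (h i) (h j) ≡ false)

RamseyProperty : ℕ → ℕ → ℕ → Set
RamseyProperty a b N = (c : Colouring N) → HasRedClique a c ⊎ HasBlueClique b c

IsRamseyNumber : ℕ → ℕ → ℕ → Set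
IsRamseyNumber a b r = RamseyProperty a b r × (∀ N → N ℕ.< r → ¬ RamseyProperty a b N)

module RealDefs (ℝ : Reals) where
  open Reals ℝ

  RamseyLE : ℕ → ℕ → R → Set
  RamseyLE a b X = ∃ λ r → IsRamseyNumber a b r × fromℕ r ≤ X

  A : ∀ {N} → Colouring N → Fin N → Fin N → R
  A c x y with x ≟ y
  ... | yes _ = 0#
  ... | no  _ = if colour c x y then 1# else 0#

  balanced : ∀ {N} → Colouring N → R → Fin N → Fin N → R
  balanced c p x y = A c x y − p

module Submission where

-- Write d(x) for the red degree of x, and p = k/(k+l), q = l/(k+l).  Then
-- Σ_y g(x,y) = d(x) − pn and Σ_y g(x,y) g(y,z) = c(x,z) − p (d(x) + d(z)) + p²n, where c(x,z)
-- counts common red neighbours.  The red neighbourhood of x contains neither a red K_k nor a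
-- blue K_{l+1}, so d(x) < r(k,l+1) ≤ f(k−1,l) C(k+l−1,k−1) ≤ (1+γ) f* C(k+l,k) p = (1+γ) pn; in the
-- same way the blue degree is below (1+δ) qn, which bounds d(x) from below.  For a red edge xz the
-- common red neighbourhood is bounded through r(k−1,l+1) and C(k+l−2,k−2) ≤ C(k+l,k) p²; for a
-- blue edge the common blue neighbourhood is bounded through r(k+1,l−1), and inclusion–exclusion
-- turns this into an expression for c(x,z).

open import Defs
import Data.Nat as N
import Data.Nat as ℕ
import Data.Nat.Properties as ℕ
open import Data.Nat using (ℕ; _∸_; _⊔_; _^_)
open import Data.Nat.Combinatorics using (_C_)
open import Data.Integer using (∣_∣)
open import Data.Fin using (Fin)
open import Data.Product using (_×_; _,_)
open import Data.Sum using (_⊎_)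
open import Relation.Nullary using (¬_)
open import Relation.Binary.PropositionalEquality using (_≡_; _≢_)

module OrderedField (ℝ : Reals) where
  open import Data.Nat using (zero; suc)
  import Data.Integer as ℤ
  import Data.Integer.Properties as ℤ
  open import Data.Integer using (ℤ; -[1+_])
  open import Data.Sign as Sign using (Sign)
  open import Data.Maybe using (Maybe; just; nothing)
  open import Data.Sum using (inj₁; inj₂)
  open import Data.Fin using (zero; suc)
  open import Data.Empty using (⊥-elim)
  open import Relation.Nullary using (yes; no)
  open import Relation.Binary.PropositionalEquality
  open import Relation.Binary.Structures using (IsTotalOrder)
  open import Algebra.Bundles using (CommutativeRing)
  import Algebra.Properties.Ring as RingProperties
  import Algebra.Properties.AbelianGroup as AbelianGroupProperties
  import Algebra.Solver.Ring.AlmostCommutativeRing as ACR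

  open Reals ℝ public

  commutativeRing : CommutativeRing _ _
  commutativeRing = record { isCommutativeRing = isCommutativeRing }

  open CommutativeRing commutativeRing public
    using ( +-assoc; +-comm; *-assoc; *-comm; +-identityˡ; +-identityʳ; *-identityˡ; *-identityʳ
          ; distribˡ; distribʳ; -‿inverseʳ; zeroˡ; zeroʳ )
  open RingProperties (CommutativeRing.ring commutativeRing) using (-‿distribˡ-*; -‿distribʳ-*)
  open AbelianGroupProperties (CommutativeRing.+-abelianGroup commutativeRing)
    using (⁻¹-involutive; ⁻¹-∙-comm; ε⁻¹≈ε; ⁻¹-anti-homo‿-)

  fromℕ-+ : ∀ m n → fromℕ (m ℕ.+ n) ≡ fromℕ m + fromℕ n
  fromℕ-+ zero    n = sym (+-identityˡ _)
  fromℕ-+ (suc m) n = begin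
    fromℕ (m ℕ.+ n) + 1#      ≡⟨ cong (_+ 1#) (fromℕ-+ m n) ⟩
    (fromℕ m + fromℕ n) + 1#  ≡⟨ +-assoc _ _ _ ⟩
    fromℕ m + (fromℕ n + 1#)  ≡⟨ cong (fromℕ m +_) (+-comm _ _) ⟩
    fromℕ m + (1# + fromℕ n)  ≡⟨ sym (+-assoc _ _ _) ⟩
    (fromℕ m + 1#) + fromℕ n  ∎
    where open ≡-Reasoning

  fromℕ-* : ∀ m n → fromℕ (m ℕ.* n) ≡ fromℕ m * fromℕ n
  fromℕ-* zero    n = sym (zeroˡ _)
  fromℕ-* (suc m) n = begin
    fromℕ (n ℕ.+ m ℕ.* n)             ≡⟨ fromℕ-+ n (m ℕ.* n) ⟩
    fromℕ n + fromℕ (m ℕ.* n)         ≡⟨ cong (fromℕ n +_) (fromℕ-* m n) ⟩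
    fromℕ n + fromℕ m * fromℕ n       ≡⟨ +-comm _ _ ⟩
    fromℕ m * fromℕ n + fromℕ n       ≡⟨ cong (fromℕ m * fromℕ n +_) (sym (*-identityˡ _)) ⟩
    fromℕ m * fromℕ n + 1# * fromℕ n  ≡⟨ sym (distribʳ _ _ _) ⟩
    (fromℕ m + 1#) * fromℕ n          ∎
    where open ≡-Reasoning

  fromℕ-*² : ∀ m n → fromℕ (m ℕ.* (n ℕ.* n)) ≡ fromℕ m * (fromℕ n * fromℕ n)
  fromℕ-*² m n = trans (fromℕ-* m (n ℕ.* n)) (cong (fromℕ m *_) (fromℕ-* n n))

  x+y≡z⇒x≡z−y : ∀ x y z → x + y ≡ z → x ≡ z − y
  x+y≡z⇒x≡z−y x y z eq = begin
    x            ≡⟨ sym (+-identityʳ x) ⟩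
    x + 0#       ≡⟨ cong (x +_) (sym (-‿inverseʳ y)) ⟩
    x + (y − y)  ≡⟨ sym (+-assoc _ _ _) ⟩
    (x + y) − y  ≡⟨ cong (_− y) eq ⟩
    z − y        ∎
    where open ≡-Reasoning

  fromℕ-∸ : ∀ m n → n ℕ.≤ m → fromℕ (m ℕ.∸ n) ≡ fromℕ m − fromℕ n
  fromℕ-∸ m n n≤m = x+y≡z⇒x≡z−y _ _ _
    (trans (sym (fromℕ-+ (m ℕ.∸ n) n)) (cong fromℕ (ℕ.m∸n+n≡m n≤m)))

  fromℤ-‿+ : ∀ n → fromℤ (ℤ.- (ℤ.+ n)) ≡ - fromℕ n
  fromℤ-‿+ zero    = sym ε⁻¹≈ε
  fromℤ-‿+ (suc n) = refl

  fromℤ-⊖ : ∀ m n → fromℤ (m ℤ.⊖ n) ≡ fromℕ m − fromℕ n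
  fromℤ-⊖ m n with ℕ.≤-<-connex n m
  ... | inj₁ n≤m = trans (cong fromℤ (ℤ.⊖-≥ n≤m)) (fromℕ-∸ m n n≤m)
  ... | inj₂ m<n = begin
    fromℤ (m ℤ.⊖ n)                ≡⟨ cong fromℤ (ℤ.⊖-< m<n) ⟩
    fromℤ (ℤ.- (ℤ.+ (n ℕ.∸ m)))      ≡⟨ fromℤ-‿+ (n ℕ.∸ m) ⟩
    - fromℕ (n ℕ.∸ m)              ≡⟨ cong -_ (fromℕ-∸ n m (ℕ.<⇒≤ m<n)) ⟩
    - (fromℕ n − fromℕ m)          ≡⟨ ⁻¹-anti-homo‿- _ _ ⟩
    fromℕ m − fromℕ n              ∎
    where open ≡-Reasoning

  fromℤ-+ : ∀ i j → fromℤ (i ℤ.+ j) ≡ fromℤ i + fromℤ j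
  fromℤ-+ -[1+ m ] -[1+ n ] = begin
    - fromℕ (suc (suc (m ℕ.+ n)))       ≡⟨ cong (λ t → - fromℕ (suc t)) (sym (ℕ.+-suc m n)) ⟩
    - fromℕ (suc m ℕ.+ suc n)           ≡⟨ cong -_ (fromℕ-+ (suc m) (suc n)) ⟩
    - (fromℕ (suc m) + fromℕ (suc n))   ≡⟨ sym (⁻¹-∙-comm _ _) ⟩
    - fromℕ (suc m) + - fromℕ (suc n)   ∎
    where open ≡-Reasoning
  fromℤ-+ -[1+ m ] (ℤ.+ n)    = trans (fromℤ-⊖ n (suc m)) (+-comm _ _)
  fromℤ-+ (ℤ.+ m)    -[1+ n ] = fromℤ-⊖ m (suc n)
  fromℤ-+ (ℤ.+ m)    (ℤ.+ n)    = fromℕ-+ m n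

  fromℤ-neg : ∀ i → fromℤ (ℤ.- i) ≡ - fromℤ i
  fromℤ-neg -[1+ n ] = sym (⁻¹-involutive _)
  fromℤ-neg (ℤ.+ n)    = fromℤ-‿+ n

  applySign : Sign → R → R
  applySign Sign.+ x = x
  applySign Sign.- x = - x

  fromℤ-◃ : ∀ s n → fromℤ (s ℤ.◃ n) ≡ applySign s (fromℕ n)
  fromℤ-◃ Sign.- n = trans (cong fromℤ (ℤ.-◃n≡-n n)) (fromℤ-‿+ n)
  fromℤ-◃ Sign.+ n = cong fromℤ (ℤ.+◃n≡+n n)

  fromℤ-sign-∣∣ : ∀ i → fromℤ i ≡ applySign (ℤ.sign i) (fromℕ ℤ.∣ i ∣)
  fromℤ-sign-∣∣ -[1+ n ] = refl
  fromℤ-sign-∣∣ (ℤ.+ n)    = refl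

  applySign-* : ∀ s t x y → applySign (s Sign.* t) (x * y) ≡ applySign s x * applySign t y
  applySign-* Sign.- Sign.- x y =
    trans (sym (⁻¹-involutive _)) (trans (cong -_ (-‿distribˡ-* x y)) (-‿distribʳ-* (- x) y))
  applySign-* Sign.- Sign.+ x y = -‿distribˡ-* x y
  applySign-* Sign.+ Sign.- x y = -‿distribʳ-* x y
  applySign-* Sign.+ Sign.+ x y = refl

  fromℤ-* : ∀ i j → fromℤ (i ℤ.* j) ≡ fromℤ i * fromℤ j
  fromℤ-* i j = begin
    fromℤ (i ℤ.* j)                         ≡⟨ fromℤ-◃ (s Sign.* t) (ℤ.∣ i ∣ ℕ.* ℤ.∣ j ∣) ⟩
    applySign (s Sign.* t) (fromℕ (ℤ.∣ i ∣ ℕ.* ℤ.∣ j ∣))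
                                            ≡⟨ cong (applySign (s Sign.* t)) (fromℕ-* ℤ.∣ i ∣ ℤ.∣ j ∣) ⟩
    applySign (s Sign.* t) (fromℕ ℤ.∣ i ∣ * fromℕ ℤ.∣ j ∣)
                                            ≡⟨ applySign-* s t (fromℕ ℤ.∣ i ∣) (fromℕ ℤ.∣ j ∣) ⟩
    applySign s (fromℕ ℤ.∣ i ∣) * applySign t (fromℕ ℤ.∣ j ∣)
                                            ≡⟨ sym (cong₂ _*_ (fromℤ-sign-∣∣ i) (fromℤ-sign-∣∣ j)) ⟩
    fromℤ i * fromℤ j                       ∎
    where
    open ≡-Reasoning
    s t : Sign
    s = ℤ.sign i
    t = ℤ.sign j

  -- A copy of fromℤ sending 1 to 1# definitionally, as the solver's 1-homo demands.
  private
    coefficientℕ : ℕ → R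
    coefficientℕ zero          = 0#
    coefficientℕ (suc zero)    = 1#
    coefficientℕ (suc (suc n)) = coefficientℕ (suc n) + 1#

    coefficientℕ≡fromℕ : ∀ n → coefficientℕ n ≡ fromℕ n
    coefficientℕ≡fromℕ zero          = refl
    coefficientℕ≡fromℕ (suc zero)    = sym (+-identityˡ 1#)
    coefficientℕ≡fromℕ (suc (suc n)) = cong (_+ 1#) (coefficientℕ≡fromℕ (suc n))

    coefficient : ℤ → R
    coefficient (ℤ.+ n)    = coefficientℕ n
    coefficient -[1+ n ]  = - coefficientℕ (suc n)

    coefficient≡fromℤ : ∀ i → coefficient i ≡ fromℤ i
    coefficient≡fromℤ (ℤ.+ n)    = coefficientℕ≡fromℕ n
    coefficient≡fromℤ -[1+ n ]  = cong -_ (coefficientℕ≡fromℕ (suc n))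

    homomorphic₂ : ∀ (_∙_ : ℤ → ℤ → ℤ) (_∘_ : R → R → R) → (∀ i j → fromℤ (i ∙ j) ≡ fromℤ i ∘ fromℤ j) →
                   ∀ i j → coefficient (i ∙ j) ≡ coefficient i ∘ coefficient j
    homomorphic₂ _∙_ _∘_ hom i j = trans (coefficient≡fromℤ (i ∙ j))
      (trans (hom i j) (sym (cong₂ _∘_ (coefficient≡fromℤ i) (coefficient≡fromℤ j))))

    almostCommutativeRing : ACR.AlmostCommutativeRing _ _
    almostCommutativeRing = ACR.fromCommutativeRing commutativeRing

    ℤ⟶R : ℤ.+-*-rawRing ACR.-Raw-AlmostCommutative⟶ almostCommutativeRing
    ℤ⟶R = record
      { ⟦_⟧    = coefficient
      ; +-homo = homomorphic₂ ℤ._+_ _+_ fromℤ-+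
      ; *-homo = homomorphic₂ ℤ._*_ _*_ fromℤ-*
      ; -‿homo = λ i → trans (coefficient≡fromℤ (ℤ.- i))
                   (trans (fromℤ-neg i) (sym (cong -_ (coefficient≡fromℤ i))))
      ; 0-homo = refl
      ; 1-homo = refl
      }

    coefficient-≟ : ∀ i j → Maybe (coefficient i ≡ coefficient j)
    coefficient-≟ i j with i ℤ.≟ j
    ... | yes i≡j = just (cong coefficient i≡j)
    ... | no  _   = nothing

  open import Algebra.Solver.Ring ℤ.+-*-rawRing almostCommutativeRing ℤ⟶R coefficient-≟ public

  private module O = IsTotalOrder isTotalOrder

  ≤-refl : ∀ {x} → x ≤ x
  ≤-refl = O.refl

  ≤-trans : ∀ {x y z} → x ≤ y → y ≤ z → x ≤ z
  ≤-trans = O.trans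

  ≤-reflexive : ∀ {x y} → x ≡ y → x ≤ y
  ≤-reflexive = O.reflexive

  ≤-antisym : ∀ {x y} → x ≤ y → y ≤ x → x ≡ y
  ≤-antisym = O.antisym

  ≤-total : ∀ x y → x ≤ y ⊎ y ≤ x
  ≤-total = O.total

  ≤-resp-≡ : ∀ {x x′ y y′} → x ≡ x′ → y ≡ y′ → x ≤ y → x′ ≤ y′
  ≤-resp-≡ refl refl x≤y = x≤y

  x≤y⇒0≤y−x : ∀ {x y} → x ≤ y → 0# ≤ y − x
  x≤y⇒0≤y−x {x} x≤y = ≤-resp-≡ (-‿inverseʳ x) refl (+-monoˡ-≤ (- x) x≤y)

  0≤y−x⇒x≤y : ∀ {x y} → 0# ≤ y − x → x ≤ y
  0≤y−x⇒x≤y {x} {y} 0≤y−x =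
    ≤-resp-≡ (+-identityˡ x) (solve 2 (λ x y → (y :- x) :+ x := y) refl x y) (+-monoˡ-≤ x 0≤y−x)

  *-monoˡ-≤-nonneg : ∀ {x y} z → 0# ≤ z → x ≤ y → x * z ≤ y * z
  *-monoˡ-≤-nonneg {x} {y} z 0≤z x≤y = 0≤y−x⇒x≤y (≤-resp-≡ refl
    (solve 3 (λ x y z → (y :- x) :* z := y :* z :- x :* z) refl x y z)
    (*-nonneg (x≤y⇒0≤y−x x≤y) 0≤z))

  *-monoʳ-≤-nonneg : ∀ {x y} z → 0# ≤ z → x ≤ y → z * x ≤ z * y
  *-monoʳ-≤-nonneg {x} {y} z 0≤z x≤y = ≤-resp-≡ (*-comm x z) (*-comm y z) (*-monoˡ-≤-nonneg z 0≤z x≤y)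

  +-monoʳ-≤ : ∀ {x y} z → x ≤ y → z + x ≤ z + y
  +-monoʳ-≤ {x} {y} z x≤y = ≤-resp-≡ (+-comm x z) (+-comm y z) (+-monoˡ-≤ z x≤y)

  +-mono-≤ : ∀ {x x′ y y′} → x ≤ x′ → y ≤ y′ → x + y ≤ x′ + y′
  +-mono-≤ {y = y} {x′} x≤x′ y≤y′ = ≤-trans (+-monoˡ-≤ y x≤x′) (+-monoʳ-≤ _ y≤y′)

  +-nonneg : ∀ {x y} → 0# ≤ x → 0# ≤ y → 0# ≤ x + y
  +-nonneg 0≤x 0≤y = ≤-resp-≡ (+-identityˡ 0#) refl (+-mono-≤ 0≤x 0≤y)

  0≤1 : 0# ≤ 1#
  0≤1 with ≤-total 0# 1#
  ... | inj₁ 0≤1 = 0≤1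
  ... | inj₂ 1≤0 = ⊥-elim (0≢1 (sym (≤-antisym 1≤0 0≤1′)))
    where
    -- if 1 ≤ 0 then 0 ≤ -1, and hence 0 ≤ (-1)·(-1) = 1
    0≤-1 : 0# ≤ - 1#
    0≤-1 = ≤-resp-≡ refl (solve 0 (con (ℤ.+ 0) :- con (ℤ.+ 1) := :- con (ℤ.+ 1)) refl) (x≤y⇒0≤y−x 1≤0)
    0≤1′ : 0# ≤ 1#
    0≤1′ = ≤-resp-≡ refl (solve 0 ((:- con (ℤ.+ 1)) :* (:- con (ℤ.+ 1)) := con (ℤ.+ 1)) refl) (*-nonneg 0≤-1 0≤-1)

  fromℕ-nonneg : ∀ n → 0# ≤ fromℕ n
  fromℕ-nonneg zero    = ≤-refl
  fromℕ-nonneg (suc n) = +-nonneg (fromℕ-nonneg n) 0≤1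

  fromℕ-mono-≤ : ∀ {m n} → m ℕ.≤ n → fromℕ m ≤ fromℕ n
  fromℕ-mono-≤ {m} {n} m≤n = ≤-resp-≡ (+-identityʳ _)
    (trans (sym (fromℕ-+ m (n ℕ.∸ m))) (cong fromℕ (ℕ.m+[n∸m]≡n m≤n)))
    (+-monoʳ-≤ (fromℕ m) (fromℕ-nonneg (n ℕ.∸ m)))

  1≤x⇒x≢0 : ∀ {x} → 1# ≤ x → x ≢ 0#
  1≤x⇒x≢0 1≤x x≡0 = 0≢1 (sym (≤-antisym (≤-resp-≡ refl x≡0 1≤x) 0≤1))

  fromℕ-≢0 : ∀ {n} → 1 ℕ.≤ n → fromℕ n ≢ 0#
  fromℕ-≢0 1≤n = 1≤x⇒x≢0 (≤-trans (≤-reflexive (sym (+-identityˡ 1#))) (fromℕ-mono-≤ 1≤n))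

  x*y≡1⇒x≢0 : ∀ {x y} → x * y ≡ 1# → x ≢ 0#
  x*y≡1⇒x≢0 {x} {y} xy≡1 x≡0 = 0≢1 (trans (sym (zeroˡ y)) (trans (cong (_* y) (sym x≡0)) xy≡1))

  ⁻¹-unique : ∀ x y → x * y ≡ 1# → y ≡ x ⁻¹
  ⁻¹-unique x y xy≡1 = begin
    y                ≡⟨ sym (*-identityʳ y) ⟩
    y * 1#           ≡⟨ cong (y *_) (sym (inverseʳ x (x*y≡1⇒x≢0 xy≡1))) ⟩
    y * (x * x ⁻¹)   ≡⟨ solve 3 (λ x y z → y :* (x :* z) := (x :* y) :* z) refl x y (x ⁻¹) ⟩
    (x * y) * x ⁻¹   ≡⟨ cong (_* x ⁻¹) xy≡1 ⟩
    1# * x ⁻¹        ≡⟨ *-identityˡ _ ⟩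
    x ⁻¹             ∎
    where open ≡-Reasoning

  ⁻¹-nonneg : ∀ {x} → 0# ≤ x → x ≢ 0# → 0# ≤ x ⁻¹
  ⁻¹-nonneg {x} 0≤x x≢0 with ≤-total 0# (x ⁻¹)
  ... | inj₁ 0≤x⁻¹ = 0≤x⁻¹
  ... | inj₂ x⁻¹≤0 = ⊥-elim (0≢1 (sym (≤-antisym 1≤0 0≤1)))
    where
    1≤0 : 1# ≤ 0#
    1≤0 = ≤-resp-≡ (trans (*-comm _ _) (inverseʳ x x≢0)) (zeroˡ x) (*-monoˡ-≤-nonneg x 0≤x x⁻¹≤0)

  x/y*y≡x : ∀ x y → y ≢ 0# → (x / y) * y ≡ x
  x/y*y≡x x y y≢0 = begin
    (x * y ⁻¹) * y  ≡⟨ *-assoc _ _ _ ⟩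
    x * (y ⁻¹ * y)  ≡⟨ cong (x *_) (trans (*-comm _ _) (inverseʳ y y≢0)) ⟩
    x * 1#          ≡⟨ *-identityʳ x ⟩
    x               ∎
    where open ≡-Reasoning

  ≡-divide : ∀ {B D K S s} → S * s ≡ 1# → D * K ≡ B * S → B ≡ D * (K * s)
  ≡-divide {B} {D} {K} {S} {s} Ss≡1 DK≡BS = begin
    B                ≡⟨ sym (*-identityʳ B) ⟩
    B * 1#           ≡⟨ cong (B *_) (sym Ss≡1) ⟩
    B * (S * s)      ≡⟨ sym (*-assoc _ _ _) ⟩
    (B * S) * s      ≡⟨ cong (_* s) (sym DK≡BS) ⟩
    (D * K) * s      ≡⟨ *-assoc _ _ _ ⟩
    D * (K * s)      ∎
    where open ≡-Reasoning

  ≤-divide² : ∀ {B D K S s} → S * s ≡ 1# → 0# ≤ s → B * (S * S) ≤ D * (K * K) → B ≤ D * ((K * s) * (K * s))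
  ≤-divide² {B} {D} {K} {S} {s} Ss≡1 0≤s BS²≤DK² = ≤-resp-≡ cancel regroup (*-monoˡ-≤-nonneg (s * s) (*-nonneg 0≤s 0≤s) BS²≤DK²)
    where
    cancel : B * (S * S) * (s * s) ≡ B
    cancel = trans (solve 3 (λ B S s → B :* (S :* S) :* (s :* s) := B :* ((S :* s) :* (S :* s))) refl B S s)
                   (trans (cong (λ u → B * (u * u)) Ss≡1) (trans (cong (B *_) (*-identityʳ 1#)) (*-identityʳ B)))
    regroup : D * (K * K) * (s * s) ≡ D * ((K * s) * (K * s))
    regroup = solve 3 (λ D K s → D :* (K :* K) :* (s :* s) := D :* ((K :* s) :* (K :* s))) refl D K s

  Σ-cong : ∀ n {h h′ : Fin n → R} → (∀ i → h i ≡ h′ i) → Σ[ n ] h ≡ Σ[ n ] h′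
  Σ-cong zero    eq = refl
  Σ-cong (suc n) eq = cong₂ _+_ (eq zero) (Σ-cong n (λ i → eq (suc i)))

  Σ-distrib-+ : ∀ n (h h′ : Fin n → R) → Σ[ n ] (λ i → h i + h′ i) ≡ Σ[ n ] h + Σ[ n ] h′
  Σ-distrib-+ zero    h h′ = sym (+-identityˡ 0#)
  Σ-distrib-+ (suc n) h h′ =
    trans (cong (h zero + h′ zero +_) (Σ-distrib-+ n (λ i → h (suc i)) (λ i → h′ (suc i))))
          (solve 4 (λ a b c d → a :+ b :+ (c :+ d) := a :+ c :+ (b :+ d)) refl (h zero) (h′ zero) _ _)

  Σ-*ˡ : ∀ n x (h : Fin n → R) → Σ[ n ] (λ i → x * h i) ≡ x * Σ[ n ] h
  Σ-*ˡ zero    x h = sym (zeroʳ x)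
  Σ-*ˡ (suc n) x h = trans (cong (x * h zero +_) (Σ-*ˡ n x (λ i → h (suc i)))) (sym (distribˡ x _ _))

  Σ-const : ∀ n x → Σ[ n ] (λ _ → x) ≡ fromℕ n * x
  Σ-const zero    x = sym (zeroˡ x)
  Σ-const (suc n) x = trans (cong (x +_) (Σ-const n x))
    (solve 2 (λ x m → x :+ m :* x := (m :+ con (ℤ.+ 1)) :* x) refl x (fromℕ n))

  private
    *-vanishing : ∀ {w e f} → e ≡ f → w * (e − f) ≡ 0#
    *-vanishing {w} {f = f} refl = trans (cong (w *_) (-‿inverseʳ f)) (zeroʳ w)

  ≤-by-certificate : ∀ {x y t w₁ e₁ f₁ w₂ e₂ f₂ w₃ e₃ f₃ w₄ e₄ f₄} →
    0# ≤ t → e₁ ≡ f₁ → e₂ ≡ f₂ → e₃ ≡ f₃ → e₄ ≡ f₄ →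
    y − x ≡ t + w₁ * (e₁ − f₁) + w₂ * (e₂ − f₂) + w₃ * (e₃ − f₃) + w₄ * (e₄ − f₄) → x ≤ y
  ≤-by-certificate {x} {y} {t} {w₁} {w₂ = w₂} {w₃ = w₃} {w₄ = w₄} 0≤t eq₁ eq₂ eq₃ eq₄ cert =
    0≤y−x⇒x≤y (≤-resp-≡ refl (sym y−x≡t) 0≤t)
    where
    y−x≡t : y − x ≡ t
    y−x≡t = trans cert (trans (cong₂ _+_ (cong₂ _+_ (cong₂ _+_ (cong (t +_) (*-vanishing {w₁} eq₁))
              (*-vanishing {w₂} eq₂)) (*-vanishing {w₃} eq₃)) (*-vanishing {w₄} eq₄))
            (solve 1 (λ t → t :+ con (ℤ.+ 0) :+ con (ℤ.+ 0) :+ con (ℤ.+ 0) :+ con (ℤ.+ 0) := t) refl t))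

  ≡-by-certificate : ∀ {x y w e f} → e ≡ f → x ≡ y + w * (e − f) → x ≡ y
  ≡-by-certificate {y = y} {w} eq cert = trans cert (trans (cong (y +_) (*-vanishing {w} eq)) (+-identityʳ y))

module Counting where
  open import Data.Nat using (ℕ; zero; suc; _+_; _≤_; _<_; _≤?_)
  open import Data.Bool using (Bool; true; false; not; _∧_)
  open import Data.Bool.Properties using (not-injective)
  open import Data.Fin using (Fin; zero; suc; inject≤)
  open import Data.Fin.Properties using (_≟_; inject≤-injective; suc-injective)
  open import Data.Product using (_×_; _,_; proj₁; proj₂; Σ)
  open import Data.Sum using (_⊎_; inj₁; inj₂)
  open import Data.Empty using (⊥-elim)
  open import Data.Unit using (⊤; tt)
  open import Function.Definitions using (Injective)
  open import Relation.Nullary using (¬_; yes; no; does)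
  open import Relation.Binary.PropositionalEquality
  open import Data.Nat.Tactic.RingSolver using (solve-∀)

  _≡ᵇ_ : ∀ {n} → Fin n → Fin n → Bool
  x ≡ᵇ y = does (x ≟ y)

  ≡ᵇ-refl : ∀ {n} (x : Fin n) → (x ≡ᵇ x) ≡ true
  ≡ᵇ-refl x with x ≟ x
  ... | yes _   = refl
  ... | no x≢x = ⊥-elim (x≢x refl)

  ≡ᵇ-sym : ∀ {n} (x y : Fin n) → (x ≡ᵇ y) ≡ (y ≡ᵇ x)
  ≡ᵇ-sym x y with x ≟ y | y ≟ x
  ... | yes _    | yes _    = refl
  ... | yes x≡y  | no  y≢x = ⊥-elim (y≢x (sym x≡y))
  ... | no  x≢y | yes y≡x  = ⊥-elim (x≢y (sym y≡x))
  ... | no  _    | no  _    = refl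

  ≢⇒≡ᵇ-false : ∀ {n} {x y : Fin n} → x ≢ y → (x ≡ᵇ y) ≡ false
  ≢⇒≡ᵇ-false {x = x} {y} x≢y with x ≟ y
  ... | yes x≡y = ⊥-elim (x≢y x≡y)
  ... | no _    = refl

  ≡ᵇ-false⇒≢ : ∀ {n} {x y : Fin n} → (x ≡ᵇ y) ≡ false → x ≢ y
  ≡ᵇ-false⇒≢ {x = x} x≡ᵇx≡false refl with () ← trans (sym (≡ᵇ-refl x)) x≡ᵇx≡false

  ∧-true⁻ : ∀ a b → a ∧ b ≡ true → (a ≡ true) × (b ≡ true)
  ∧-true⁻ true true _ = refl , refl

  sucIf : Bool → ℕ → ℕ
  sucIf true  m = suc m
  sucIf false m = m

  count : ∀ {n} → (Fin n → Bool) → ℕ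
  count {zero}  P = 0
  count {suc n} P = sucIf (P zero) (count (λ i → P (suc i)))

  count-cong : ∀ {n} {P Q : Fin n → Bool} → (∀ y → P y ≡ Q y) → count P ≡ count Q
  count-cong {zero}  eq = refl
  count-cong {suc n} eq = cong₂ sucIf (eq zero) (count-cong (λ y → eq (suc y)))

  count-remove : ∀ {n} (x : Fin n) (P : Fin n → Bool) →
    count P ≡ count (λ y → not (x ≡ᵇ y) ∧ P y) + sucIf (P x) 0
  count-remove {suc n} zero    P = sucIf-+ (P zero) (count (λ i → P (suc i)))
    where
    sucIf-+ : ∀ b m → sucIf b m ≡ m + sucIf b 0
    sucIf-+ true  m = ℕ.+-comm 1 m
    sucIf-+ false m = sym (ℕ.+-identityʳ m)
  count-remove {suc n} (suc x) P =
    trans (cong (sucIf (P zero)) (count-remove x (λ i → P (suc i))))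
          (sucIf-assoc (P zero) _ _)
    where
    sucIf-assoc : ∀ b m v → sucIf b (m + v) ≡ sucIf b m + v
    sucIf-assoc true  m v = refl
    sucIf-assoc false m v = refl

  count-complement : ∀ {n} (P : Fin n → Bool) → count P + count (λ y → not (P y)) ≡ n
  count-complement {zero}  P = refl
  count-complement {suc n} P = step (P zero) _ _ (count-complement (λ i → P (suc i)))
    where
    step : ∀ b m m′ → m + m′ ≡ n → sucIf b m + sucIf (not b) m′ ≡ suc n
    step true  m m′ eq = cong suc eq
    step false m m′ eq = trans (ℕ.+-suc m m′) (cong suc eq)

  count-inclusion-exclusion : ∀ {n} (P Q : Fin n → Bool) →
    count (λ y → not (P y) ∧ not (Q y)) + count P + count Q ≡ n + count (λ y → P y ∧ Q y)
  count-inclusion-exclusion {zero}  P Q = refl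
  count-inclusion-exclusion {suc n} P Q =
    step (P zero) (Q zero) _ _ _ _ (count-inclusion-exclusion (λ i → P (suc i)) (λ i → Q (suc i)))
    where
    step : ∀ p q a b c d → a + b + c ≡ n + d →
           sucIf (not p ∧ not q) a + sucIf p b + sucIf q c ≡ suc n + sucIf (p ∧ q) d
    step true true a b c d eq = begin
      a + suc b + suc c          ≡⟨ lemma a b c ⟩
      suc (suc (a + b + c))      ≡⟨ cong (λ t → suc (suc t)) eq ⟩
      suc (suc (n + d))          ≡⟨ cong suc (sym (ℕ.+-suc n d)) ⟩
      suc n + suc d              ∎
      where
      open ≡-Reasoning
      lemma : ∀ a b c → a + suc b + suc c ≡ suc (suc (a + b + c))
      lemma = solve-∀
    step true  false a b c d eq = trans (cong (_+ c) (ℕ.+-suc a b)) (cong suc eq)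
    step false true  a b c d eq = trans (ℕ.+-suc (a + b) c) (cong suc eq)
    step false false a b c d eq = cong suc eq

  Enumeration : ∀ {n} → (Fin n → Bool) → Set
  Enumeration {n} P = Σ (Fin (count P) → Fin n) λ e → Injective _≡_ _≡_ e × (∀ i → P (e i) ≡ true)

  enumerate : ∀ {n} (P : Fin n → Bool) → Enumeration P
  enumerate {zero}  P = (λ ()) , (λ {x} {}) , (λ ())
  enumerate {suc n} P = extend (P zero) refl (enumerate (λ i → P (suc i)))
    where
    extend : (b : Bool) → P zero ≡ b → Enumeration (λ i → P (suc i)) →
      Σ (Fin (sucIf b (count (λ i → P (suc i)))) → Fin (suc n)) λ e →
        Injective _≡_ _≡_ e × (∀ i → P (e i) ≡ true)
    extend false _ (e , e-inj , e-sat) = (λ i → suc (e i)) , (λ eq → e-inj (suc-injective eq)) , e-sat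
    extend true P0 (e , e-inj , e-sat) = e′ , e′-inj , e′-sat
      where
      e′ : Fin (suc (count (λ i → P (suc i)))) → Fin (suc n)
      e′ zero    = zero
      e′ (suc i) = suc (e i)
      e′-inj : Injective _≡_ _≡_ e′
      e′-inj {zero}  {zero}  _  = refl
      e′-inj {suc i} {suc j} eq = cong suc (e-inj (suc-injective eq))
      e′-sat : ∀ i → P (e′ i) ≡ true
      e′-sat zero    = P0
      e′-sat (suc i) = e-sat i

  redNbr : ∀ {n} → Colouring n → Fin n → Fin n → Bool
  redNbr c x y = not (x ≡ᵇ y) ∧ colour c x y

  blueNbr : ∀ {n} → Colouring n → Fin n → Fin n → Bool
  blueNbr c x y = not (x ≡ᵇ y) ∧ not (colour c x y)

  commonBlueNbr : ∀ {n} → Colouring n → Fin n → Fin n → Fin n → Bool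
  commonBlueNbr c x z y = not (z ≡ᵇ y) ∧ (not (x ≡ᵇ y) ∧ (not (redNbr c x y) ∧ not (redNbr c y z)))

  redDegree blueDegree : ∀ {n} → Colouring n → Fin n → ℕ
  redDegree  c x = count (redNbr c x)
  blueDegree c x = count (blueNbr c x)

  redCodegree blueCodegree : ∀ {n} → Colouring n → Fin n → Fin n → ℕ
  redCodegree  c x z = count (λ y → redNbr c x y ∧ redNbr c y z)
  blueCodegree c x z = count (commonBlueNbr c x z)

  redNbr-sym : ∀ {n} (c : Colouring n) x y → redNbr c x y ≡ redNbr c y x
  redNbr-sym c x y = cong₂ (λ a b → not a ∧ b) (≡ᵇ-sym x y) (symm c x y)

  redNbr-true : ∀ {n} (c : Colouring n) x y → redNbr c x y ≡ true → (y ≢ x) × (colour c x y ≡ true)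
  redNbr-true c x y yRed with ∧-true⁻ (not (x ≡ᵇ y)) (colour c x y) yRed
  ... | x≢ᵇy , xy-red = ≢-sym (≡ᵇ-false⇒≢ (not-injective x≢ᵇy)) , xy-red

  blueNbr-true : ∀ {n} (c : Colouring n) x y → blueNbr c x y ≡ true → (y ≢ x) × (colour c x y ≡ false)
  blueNbr-true c x y yBlue with ∧-true⁻ (not (x ≡ᵇ y)) (not (colour c x y)) yBlue
  ... | x≢ᵇy , xy-blue = ≢-sym (≡ᵇ-false⇒≢ (not-injective x≢ᵇy)) , not-injective xy-blue

  commonBlueNbr-true : ∀ {n} (c : Colouring n) x z y → commonBlueNbr c x z y ≡ true →
    ((y ≢ x) × (colour c x y ≡ false)) × ((y ≢ z) × (colour c z y ≡ false))
  commonBlueNbr-true c x z y yBlue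
    with ∧-true⁻ (not (z ≡ᵇ y)) _ yBlue
  ... | z≢ᵇy , rest with ∧-true⁻ (not (x ≡ᵇ y)) _ rest
  ... | x≢ᵇy , rest′ with ∧-true⁻ (not (redNbr c x y)) _ rest′
  ... | xy-notRed , yz-notRed =
    (≢-sym (≡ᵇ-false⇒≢ x≡ᵇy) , notRed⇒blue x≡ᵇy xy-notRed) ,
    (≢-sym (≡ᵇ-false⇒≢ z≡ᵇy) ,
     trans (symm c z y) (notRed⇒blue (trans (≡ᵇ-sym y z) z≡ᵇy) yz-notRed))
    where
    x≡ᵇy : (x ≡ᵇ y) ≡ false
    x≡ᵇy = not-injective x≢ᵇy
    z≡ᵇy : (z ≡ᵇ y) ≡ false
    z≡ᵇy = not-injective z≢ᵇy
    notRed⇒blue : ∀ {b col} → b ≡ false → not (not b ∧ col) ≡ true → col ≡ false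
    notRed⇒blue refl notRed = not-injective notRed

  Clique : ∀ {n} → Colouring n → Bool → ℕ → Set
  Clique {n} c col s = Σ (Fin s → Fin n) λ h →
    Injective _≡_ _≡_ h × (∀ i j → i ≢ j → colour c (h i) (h j) ≡ col)

  record CliqueWithin {n} (c : Colouring n) (col : Bool) (s : ℕ) (Q : Fin n → Set) : Set where
    constructor _⊆_
    field
      clique : Clique c col s
      inside : ∀ i → Q (proj₁ clique i)
  open CliqueWithin

  ramsey-within : ∀ {a b r n} → RamseyProperty a b r → (c : Colouring n) (P : Fin n → Bool) → r ≤ count P →
    CliqueWithin c true a (λ y → P y ≡ true) ⊎ CliqueWithin c false b (λ y → P y ≡ true)
  ramsey-within {a} {b} {r} {n} RP c P r≤|P| = restrict (RP c′)
    where
    enum : Enumeration P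
    enum = enumerate P
    e : Fin r → Fin n
    e i = proj₁ enum (inject≤ i r≤|P|)
    e-inj : Injective _≡_ _≡_ e
    e-inj eq = inject≤-injective r≤|P| r≤|P| _ _ (proj₁ (proj₂ enum) eq)
    c′ : Colouring r
    c′ = record { colour = λ i j → colour c (e i) (e j) ; symm = λ i j → symm c (e i) (e j) }
    restrict : HasRedClique a c′ ⊎ HasBlueClique b c′ →
      CliqueWithin c true a (λ y → P y ≡ true) ⊎ CliqueWithin c false b (λ y → P y ≡ true)
    restrict (inj₁ (h , h-inj , h-red))  = inj₁ (((λ i → e (h i)) , (λ eq → h-inj (e-inj eq)) , h-red) ⊆ λ _ → proj₂ (proj₂ enum) _)
    restrict (inj₂ (h , h-inj , h-blue)) = inj₂ (((λ i → e (h i)) , (λ eq → h-inj (e-inj eq)) , h-blue) ⊆ λ _ → proj₂ (proj₂ enum) _)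

  extend-clique : ∀ {n} {c : Colouring n} {col s} (x : Fin n) {Q Q′ : Fin n → Set} →
    (∀ y → Q y → (y ≢ x) × (colour c x y ≡ col)) → (∀ y → Q y → Q′ y) → Q′ x →
    CliqueWithin c col s Q → CliqueWithin c col (suc s) Q′
  extend-clique {n} {c} {col} {s} x {Q} {Q′} adjacent Q⇒Q′ Q′x ((h , h-inj , h-col) ⊆ h-Q) =
    (h′ , h′-inj , h′-col) ⊆ h′-Q′
    where
    h′ : Fin (suc s) → Fin n
    h′ zero    = x
    h′ (suc i) = h i
    h′-inj : Injective _≡_ _≡_ h′
    h′-inj {zero}  {zero}  _  = refl
    h′-inj {zero}  {suc j} eq = ⊥-elim (proj₁ (adjacent (h j) (h-Q j)) (sym eq))
    h′-inj {suc i} {zero}  eq = ⊥-elim (proj₁ (adjacent (h i) (h-Q i)) eq)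
    h′-inj {suc i} {suc j} eq = cong suc (h-inj eq)
    h′-col : ∀ i j → i ≢ j → colour c (h′ i) (h′ j) ≡ col
    h′-col zero    zero    i≢j = ⊥-elim (i≢j refl)
    h′-col zero    (suc j) _   = proj₂ (adjacent (h j) (h-Q j))
    h′-col (suc i) zero    _   = trans (symm c (h i) x) (proj₂ (adjacent (h i) (h-Q i)))
    h′-col (suc i) (suc j) i≢j = h-col i j (λ eq → i≢j (cong suc eq))
    h′-Q′ : ∀ i → Q′ (h′ i)
    h′-Q′ zero    = Q′x
    h′-Q′ (suc i) = Q⇒Q′ (h i) (h-Q i)

  module NoCliques {n} (c : Colouring n) {a b : ℕ}
    (noRed : ¬ HasRedClique a c) (noBlue : ¬ HasBlueClique b c) where

    count<ramsey : ∀ {a′ b′ r} → RamseyProperty a′ b′ r → (P : Fin n → Bool) →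
      ¬ CliqueWithin c true a′ (λ y → P y ≡ true) → ¬ CliqueWithin c false b′ (λ y → P y ≡ true) →
      count P < r
    count<ramsey {r = r} RP P noRed′ noBlue′ with r ≤? count P
    ... | no r≰|P| = ℕ.≰⇒> r≰|P|
    ... | yes r≤|P| with ramsey-within RP c P r≤|P|
    ...   | inj₁ red  = ⊥-elim (noRed′ red)
    ...   | inj₂ blue = ⊥-elim (noBlue′ blue)

    redDegree<ramsey : ∀ {a′ r} → RamseyProperty a′ b r → a′ + 1 ≡ a → ∀ x → redDegree c x < r
    redDegree<ramsey {a′} RP a′+1≡a x = count<ramsey RP (redNbr c x)
      (λ red → noRed (subst (Clique c true) (trans (ℕ.+-comm 1 a′) a′+1≡a)
        (clique (extend-clique x (redNbr-true c x) (λ _ _ → tt) tt red))))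
      (λ blue → noBlue (clique blue))

    blueDegree<ramsey : ∀ {b′ r} → RamseyProperty a b′ r → b′ + 1 ≡ b → ∀ x → blueDegree c x < r
    blueDegree<ramsey {b′} RP b′+1≡b x = count<ramsey RP (blueNbr c x)
      (λ red → noRed (clique red))
      (λ blue → noBlue (subst (Clique c false) (trans (ℕ.+-comm 1 b′) b′+1≡b)
        (clique (extend-clique x (blueNbr-true c x) (λ _ _ → tt) tt blue))))

    redCodegree<ramsey : ∀ {a″ r} → RamseyProperty a″ b r → a″ + 2 ≡ a →
      ∀ x z → x ≢ z → colour c x z ≡ true → redCodegree c x z < r
    redCodegree<ramsey {a″} RP a″+2≡a x z x≢z xz-red = count<ramsey RP _
      (λ red → noRed (subst (Clique c true) (trans (ℕ.+-comm 2 a″) a″+2≡a) (clique (extend-by-x (extend-by-z red)))))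
      (λ blue → noBlue (clique blue))
      where
      common : ∀ y → (redNbr c x y ∧ redNbr c y z) ≡ true → redNbr c x y ≡ true × redNbr c y z ≡ true
      common y = ∧-true⁻ (redNbr c x y) (redNbr c y z)
      extend-by-z : CliqueWithin c true a″ (λ y → (redNbr c x y ∧ redNbr c y z) ≡ true) →
                    CliqueWithin c true (suc a″) (λ y → (y ≢ x) × (colour c x y ≡ true))
      extend-by-z = extend-clique z
        (λ y yRed → let y≢z , yz-red = redNbr-true c y z (proj₂ (common y yRed))
                    in ≢-sym y≢z , trans (symm c z y) yz-red)
        (λ y yRed → redNbr-true c x y (proj₁ (common y yRed)))
        (≢-sym x≢z , xz-red)
      extend-by-x : CliqueWithin c true (suc a″) (λ y → (y ≢ x) × (colour c x y ≡ true)) →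
                    CliqueWithin c true (suc (suc a″)) (λ _ → ⊤)
      extend-by-x = extend-clique x (λ y yRed → yRed) (λ _ _ → tt) tt

    blueCodegree<ramsey : ∀ {b″ r} → RamseyProperty a b″ r → b″ + 2 ≡ b →
      ∀ x z → x ≢ z → colour c x z ≡ false → blueCodegree c x z < r
    blueCodegree<ramsey {b″} RP b″+2≡b x z x≢z xz-blue = count<ramsey RP _
      (λ red → noRed (clique red))
      (λ blue → noBlue (subst (Clique c false) (trans (ℕ.+-comm 2 b″) b″+2≡b) (clique (extend-by-x (extend-by-z blue)))))
      where
      extend-by-z : CliqueWithin c false b″ (λ y → commonBlueNbr c x z y ≡ true) →
                    CliqueWithin c false (suc b″) (λ y → (y ≢ x) × (colour c x y ≡ false))
      extend-by-z = extend-clique z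
        (λ y yBlue → proj₂ (commonBlueNbr-true c x z y yBlue))
        (λ y yBlue → proj₁ (commonBlueNbr-true c x z y yBlue))
        (≢-sym x≢z , xz-blue)
      extend-by-x : CliqueWithin c false (suc b″) (λ y → (y ≢ x) × (colour c x y ≡ false)) →
                    CliqueWithin c false (suc (suc b″)) (λ _ → ⊤)
      extend-by-x = extend-clique x (λ y yBlue → yBlue) (λ _ _ → tt) tt

  redDegree+blueDegree : ∀ {n} (c : Colouring n) x → redDegree c x + suc (blueDegree c x) ≡ n
  redDegree+blueDegree c x =
    trans (cong (redDegree c x +_) |notRed|) (count-complement (redNbr c x))
    where
    notRed⇔blue : ∀ e col → not e ∧ not (not e ∧ col) ≡ not e ∧ not col
    notRed⇔blue true  col = refl
    notRed⇔blue false col = refl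
    |notRed| : suc (blueDegree c x) ≡ count (λ y → not (redNbr c x y))
    |notRed| = sym (begin
      count (λ y → not (redNbr c x y))
        ≡⟨ count-remove x (λ y → not (redNbr c x y)) ⟩
      count (λ y → not (x ≡ᵇ y) ∧ not (redNbr c x y)) + sucIf (not (redNbr c x x)) 0
        ≡⟨ cong₂ _+_ (count-cong (λ y → notRed⇔blue (x ≡ᵇ y) (colour c x y)))
                     (cong (λ b → sucIf (not (not b ∧ colour c x x)) 0) (≡ᵇ-refl x)) ⟩
      blueDegree c x + 1
        ≡⟨ ℕ.+-comm _ 1 ⟩
      suc (blueDegree c x) ∎)
      where open ≡-Reasoning

  -- the vertices red-adjacent to neither x nor z are x, z and their common blue neighbours
  blueCodegree+redDegrees : ∀ {n} (c : Colouring n) x z → x ≢ z → colour c x z ≡ false →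
    blueCodegree c x z + 2 + redDegree c x + redDegree c z ≡ n + redCodegree c x z
  blueCodegree+redDegrees {n} c x z x≢z xz-blue = begin
    blueCodegree c x z + 2 + redDegree c x + redDegree c z
      ≡⟨ cong₂ (λ u v → u + redDegree c x + v)
           (sym |notRed-x-z|) (count-cong (λ y → redNbr-sym c z y)) ⟩
    count notRed-x-z + redDegree c x + count (λ y → redNbr c y z)
      ≡⟨ count-inclusion-exclusion (redNbr c x) (λ y → redNbr c y z) ⟩
    _ + redCodegree c x z ∎
    where
    open ≡-Reasoning
    notRed-x-z notRed-x-z′ : Fin n → Bool
    notRed-x-z  y = not (redNbr c x y) ∧ not (redNbr c y z)
    notRed-x-z′ y = not (x ≡ᵇ y) ∧ notRed-x-z y
    |notRed-x-z| : count notRed-x-z ≡ blueCodegree c x z + 2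
    |notRed-x-z| = begin
      count notRed-x-z                                         ≡⟨ count-remove x notRed-x-z ⟩
      count notRed-x-z′ + sucIf (notRed-x-z x) 0               ≡⟨ cong (count notRed-x-z′ +_) x-counted ⟩
      count notRed-x-z′ + 1                                    ≡⟨ cong (_+ 1) (count-remove z notRed-x-z′) ⟩
      blueCodegree c x z + sucIf (notRed-x-z′ z) 0 + 1         ≡⟨ cong (λ t → blueCodegree c x z + t + 1) z-counted ⟩
      blueCodegree c x z + 1 + 1                               ≡⟨ ℕ.+-assoc _ 1 1 ⟩
      blueCodegree c x z + 2                                   ∎
      where
      x-counted : sucIf (notRed-x-z x) 0 ≡ 1
      x-counted rewrite ≡ᵇ-refl x | ≢⇒≡ᵇ-false x≢z | xz-blue = refl
      z-counted : sucIf (notRed-x-z′ z) 0 ≡ 1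
      z-counted rewrite ≡ᵇ-refl z | ≢⇒≡ᵇ-false x≢z | xz-blue = refl

module Binomial where
  open import Data.Nat
  open import Data.Nat.Properties
  open import Data.Nat.Combinatorics
  open import Data.Nat.Tactic.RingSolver
  open import Relation.Binary.PropositionalEquality

  [1+n]C[1+k]*[1+k]≡nCk*[1+n] : ∀ n k → (suc n C suc k) * suc k ≡ (n C k) * suc n
  [1+n]C[1+k]*[1+k]≡nCk*[1+n] zero    zero    = refl
  [1+n]C[1+k]*[1+k]≡nCk*[1+n] zero    (suc k) = cong (_* suc (suc k)) (k>n⇒nCk≡0 {1} {suc (suc k)} (s≤s (s≤s z≤n)))
  [1+n]C[1+k]*[1+k]≡nCk*[1+n] (suc m) zero    = begin
    (suc (suc m) C 1) * 1  ≡⟨ *-identityʳ _ ⟩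
    suc (suc m) C 1        ≡⟨ nC1≡n (suc (suc m)) ⟩
    suc (suc m)            ≡⟨ sym (*-identityˡ (suc (suc m))) ⟩
    1 * suc (suc m)        ∎
    where open ≡-Reasoning
  [1+n]C[1+k]*[1+k]≡nCk*[1+n] (suc m) (suc j) = begin
    (suc (suc m) C suc (suc j)) * suc (suc j)
      ≡⟨ cong (_* suc (suc j)) (sym (nCk+nC[k+1]≡[n+1]C[k+1] (suc m) (suc j))) ⟩
    (a + e) * suc (suc j)                       ≡⟨ expand a e j ⟩
    (a * suc j + e * suc (suc j)) + a
      ≡⟨ cong₂ (λ u v → u + v + a) ([1+n]C[1+k]*[1+k]≡nCk*[1+n] m j) ([1+n]C[1+k]*[1+k]≡nCk*[1+n] m (suc j)) ⟩
    (b * suc m + d * suc m) + a                 ≡⟨ factor b d m a ⟩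
    (b + d) * suc m + a                         ≡⟨ cong (λ u → u * suc m + a) (nCk+nC[k+1]≡[n+1]C[k+1] m j) ⟩
    a * suc m + a                               ≡⟨ collect a m ⟩
    a * suc (suc m)                             ∎
    where
    open ≡-Reasoning
    a e b d : ℕ
    a = suc m C suc j
    e = suc m C suc (suc j)
    b = m C j
    d = m C suc j
    expand : ∀ a e j → (a + e) * suc (suc j) ≡ (a * suc j + e * suc (suc j)) + a
    expand = solve-∀
    factor : ∀ b d m a → (b * suc m + d * suc m) + a ≡ (b + d) * suc m + a
    factor = solve-∀
    collect : ∀ a m → a * suc m + a ≡ a * suc (suc m)
    collect = solve-∀

  [k+l]Ck≡[l+k]Cl : ∀ k l → (k + l) C k ≡ (l + k) C l
  [k+l]Ck≡[l+k]Cl k l = begin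
    (k + l) C k              ≡⟨ nCk≡nC[n∸k] (m≤m+n k l) ⟩
    (k + l) C ((k + l) ∸ k)  ≡⟨ cong ((k + l) C_) (m+n∸m≡n k l) ⟩
    (k + l) C l              ≡⟨ cong (_C l) (+-comm k l) ⟩
    (l + k) C l              ∎
    where open ≡-Reasoning

  0<[k+l]Ck : ∀ k l → 0 < (k + l) C k
  0<[k+l]Ck zero    l = s≤s z≤n
  0<[k+l]Ck (suc k) l = n≢0⇒n>0 λ C≡0 → <-irrefl refl (subst (0 <_) (smaller≡0 C≡0) (0<[k+l]Ck k l))
    where
    smaller≡0 : (suc k + l) C suc k ≡ 0 → (k + l) C k ≡ 0
    smaller≡0 C≡0 = m*n≡0⇒m≡0 _ (suc (k + l))
      (trans (sym ([1+n]C[1+k]*[1+k]≡nCk*[1+n] (k + l) k)) (cong (_* suc k) C≡0))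

  [k+l]Ck*k≡[k∸1+l]C[k∸1]*[k+l] : ∀ k l → 1 ≤ k → ((k + l) C k) * k ≡ (((k ∸ 1) + l) C (k ∸ 1)) * (k + l)
  [k+l]Ck*k≡[k∸1+l]C[k∸1]*[k+l] (suc k) l _ = [1+n]C[1+k]*[1+k]≡nCk*[1+n] (k + l) k

  [k+l]Ck*l≡[k+l∸1]Ck*[k+l] : ∀ k l → 1 ≤ l → ((k + l) C k) * l ≡ (((k + l) ∸ 1) C k) * (k + l)
  [k+l]Ck*l≡[k+l∸1]Ck*[k+l] k (suc l) _ = begin
    ((k + suc l) C k) * suc l              ≡⟨ cong (_* suc l) ([k+l]Ck≡[l+k]Cl k (suc l)) ⟩
    ((suc l + k) C suc l) * suc l          ≡⟨ [1+n]C[1+k]*[1+k]≡nCk*[1+n] (l + k) l ⟩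
    ((l + k) C l) * (suc l + k)            ≡⟨ cong₂ _*_ (sym ([k+l]Ck≡[l+k]Cl k l)) (+-comm (suc l) k) ⟩
    ((k + l) C k) * (k + suc l)            ≡⟨ cong (λ t → (t C k) * (k + suc l)) (sym (cong (_∸ 1) (+-suc k l))) ⟩
    (((k + suc l) ∸ 1) C k) * (k + suc l)  ∎
    where open ≡-Reasoning

  -- two absorption steps, with (k+1)/(k+2) ≤ (k+l+1)/(k+l+2) in between
  [k∸2+l]C[k∸2]*[k+l]²≤[k+l]Ck*k² : ∀ k l → 2 ≤ k →
    (((k ∸ 2) + l) C (k ∸ 2)) * ((k + l) * (k + l)) ≤ ((k + l) C k) * (k * k)
  [k∸2+l]C[k∸2]*[k+l]²≤[k+l]Ck*k² (suc zero) l (s≤s ())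
  [k∸2+l]C[k∸2]*[k+l]²≤[k+l]Ck*k² (suc (suc a)) l _ = *-cancelˡ-≤ (suc a) (begin
    suc a * (X * (suc (suc T) * suc (suc T)))   ≡⟨ s₁ a X T ⟩
    X * suc (suc T) * (suc (suc T) * suc a)     ≤⟨ *-monoʳ-≤ (X * suc (suc T)) ratio ⟩
    X * suc (suc T) * (suc T * suc (suc a))     ≡⟨ s₂ a X T ⟩
    (X * suc T) * (suc (suc T) * suc (suc a))
      ≡⟨ cong (_* (suc (suc T) * suc (suc a))) (sym ([1+n]C[1+k]*[1+k]≡nCk*[1+n] T a)) ⟩
    (Y * suc a) * (suc (suc T) * suc (suc a))   ≡⟨ s₃ a Y T ⟩
    (Y * suc (suc T)) * (suc a * suc (suc a))
      ≡⟨ cong (_* (suc a * suc (suc a))) (sym ([1+n]C[1+k]*[1+k]≡nCk*[1+n] (suc T) (suc a))) ⟩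
    (Z * suc (suc a)) * (suc a * suc (suc a))   ≡⟨ s₄ a Z ⟩
    suc a * (Z * (suc (suc a) * suc (suc a)))   ∎)
    where
    open ≤-Reasoning
    T X Y Z : ℕ
    T = a + l
    X = T C a
    Y = suc T C suc a
    Z = suc (suc T) C suc (suc a)
    ratio : suc (suc T) * suc a ≤ suc T * suc (suc a)
    ratio = subst (suc (suc T) * suc a ≤_) (cross a l) (m≤m+n _ l)
      where
      cross : ∀ a l → suc (suc (a + l)) * suc a + l ≡ suc (a + l) * suc (suc a)
      cross = solve-∀
    s₁ : ∀ a X T → suc a * (X * (suc (suc T) * suc (suc T))) ≡ X * suc (suc T) * (suc (suc T) * suc a)
    s₁ = solve-∀
    s₂ : ∀ a X T → X * suc (suc T) * (suc T * suc (suc a)) ≡ (X * suc T) * (suc (suc T) * suc (suc a))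
    s₂ = solve-∀
    s₃ : ∀ a Y T → (Y * suc a) * (suc (suc T) * suc (suc a)) ≡ (Y * suc (suc T)) * (suc a * suc (suc a))
    s₃ = solve-∀
    s₄ : ∀ a Z → (Z * suc (suc a)) * (suc a * suc (suc a)) ≡ suc a * (Z * (suc (suc a) * suc (suc a)))
    s₄ = solve-∀

  [k+l∸2]Ck*[k+l]²≤[k+l]Ck*l² : ∀ k l → 2 ≤ l →
    (((k + l) ∸ 2) C k) * ((k + l) * (k + l)) ≤ ((k + l) C k) * (l * l)
  [k+l∸2]Ck*[k+l]²≤[k+l]Ck*l² k (suc zero) (s≤s ())
  [k+l∸2]Ck*[k+l]²≤[k+l]Ck*l² k (suc (suc b)) _ = begin
    (((k + l) ∸ 2) C k) * ((k + l) * (k + l))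
      ≡⟨ cong (λ t → (t C k) * ((k + l) * (k + l))) k+l∸2≡k+b ⟩
    ((k + b) C k) * ((k + l) * (k + l))
      ≡⟨ cong₂ (λ u v → u * (v * v)) ([k+l]Ck≡[l+k]Cl k b) (+-comm k l) ⟩
    ((b + k) C b) * ((l + k) * (l + k))      ≤⟨ [k∸2+l]C[k∸2]*[k+l]²≤[k+l]Ck*k² l k (s≤s (s≤s z≤n)) ⟩
    ((l + k) C l) * (l * l)                  ≡⟨ cong (_* (l * l)) (sym ([k+l]Ck≡[l+k]Cl k l)) ⟩
    ((k + l) C k) * (l * l)                  ∎
    where
    open ≤-Reasoning
    l : ℕ
    l = suc (suc b)
    k+l∸2≡k+b : (k + l) ∸ 2 ≡ k + b
    k+l∸2≡k+b = cong (_∸ 2) (trans (+-suc k (suc b)) (cong suc (+-suc k b)))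

module BalancedSums (ℝ : Reals) where
  open OrderedField ℝ
  open Counting
  open RealDefs ℝ
  open import Data.Nat using (zero; suc)
  open import Data.Bool using (Bool; true; false; _∧_; if_then_else_)
  open import Data.Fin using (Fin; zero; suc)
  open import Data.Fin.Properties using (_≟_)
  open import Relation.Nullary using (yes; no)
  open import Relation.Binary.PropositionalEquality

  indicator : Bool → R
  indicator b = if b then 1# else 0#

  indicator-∧ : ∀ a b → indicator a * indicator b ≡ indicator (a ∧ b)
  indicator-∧ true  b = *-identityˡ (indicator b)
  indicator-∧ false b = zeroˡ (indicator b)

  Σ-indicator : ∀ {n} (P : Fin n → Bool) → Σ[ n ] (λ y → indicator (P y)) ≡ fromℕ (count P)
  Σ-indicator {zero}  P = refl
  Σ-indicator {suc n} P =
    trans (cong (indicator (P zero) +_) (Σ-indicator (λ i → P (suc i)))) (step (P zero) _)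
    where
    step : ∀ b m → indicator b + fromℕ m ≡ fromℕ (sucIf b m)
    step true  m = +-comm 1# (fromℕ m)
    step false m = +-identityˡ (fromℕ m)

  A≡indicator-redNbr : ∀ {n} (c : Colouring n) x y → A c x y ≡ indicator (redNbr c x y)
  A≡indicator-redNbr c x y with x ≟ y
  ... | yes _ = refl
  ... | no  _ = refl

  Σ-A : ∀ {n} (c : Colouring n) x → Σ[ n ] (λ y → A c x y) ≡ fromℕ (redDegree c x)
  Σ-A {n} c x = trans (Σ-cong n (A≡indicator-redNbr c x)) (Σ-indicator (redNbr c x))

  Σ-A-sym : ∀ {n} (c : Colouring n) z → Σ[ n ] (λ y → A c y z) ≡ fromℕ (redDegree c z)
  Σ-A-sym {n} c z = trans (Σ-cong n (λ y → trans (A≡indicator-redNbr c y z) (cong indicator (redNbr-sym c y z))))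
                          (Σ-indicator (redNbr c z))

  Σ-A*A : ∀ {n} (c : Colouring n) x z → Σ[ n ] (λ y → A c x y * A c y z) ≡ fromℕ (redCodegree c x z)
  Σ-A*A {n} c x z = trans
    (Σ-cong n (λ y → trans (cong₂ _*_ (A≡indicator-redNbr c x y) (A≡indicator-redNbr c y z))
                           (indicator-∧ (redNbr c x y) (redNbr c y z))))
    (Σ-indicator (λ y → redNbr c x y ∧ redNbr c y z))

  Σ-balanced : ∀ {n} (c : Colouring n) p x →
    Σ[ n ] (λ y → balanced c p x y) ≡ fromℕ (redDegree c x) + fromℕ n * (- p)
  Σ-balanced {n} c p x =
    trans (Σ-distrib-+ n (λ y → A c x y) (λ _ → - p)) (cong₂ _+_ (Σ-A c x) (Σ-const n (- p)))

  Σ-balanced-product : ∀ {n} (c : Colouring n) p x z →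
    Σ[ n ] (λ y → balanced c p x y * balanced c p y z)
      ≡ fromℕ (redCodegree c x z) + (- p) * fromℕ (redDegree c x) + (- p) * fromℕ (redDegree c z) + fromℕ n * (p * p)
  Σ-balanced-product {n} c p x z = begin
    Σ[ n ] (λ y → balanced c p x y * balanced c p y z)
      ≡⟨ Σ-cong n (λ y → expand (A c x y) (A c y z)) ⟩
    Σ[ n ] (λ y → (A c x y * A c y z + (- p) * A c x y + (- p) * A c y z) + p * p)
      ≡⟨ Σ-distrib-+ n _ _ ⟩
    Σ[ n ] (λ y → A c x y * A c y z + (- p) * A c x y + (- p) * A c y z) + Σ[ n ] (λ _ → p * p)
      ≡⟨ cong₂ _+_ (Σ-distrib-+ n _ _) (Σ-const n (p * p)) ⟩
    Σ[ n ] (λ y → A c x y * A c y z + (- p) * A c x y) + Σ[ n ] (λ y → (- p) * A c y z) + fromℕ n * (p * p)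
      ≡⟨ cong (_+ fromℕ n * (p * p)) (cong₂ _+_ (Σ-distrib-+ n _ _) (Σ-*ˡ n (- p) (λ y → A c y z))) ⟩
    Σ[ n ] (λ y → A c x y * A c y z) + Σ[ n ] (λ y → (- p) * A c x y) + (- p) * Σ[ n ] (λ y → A c y z)
      + fromℕ n * (p * p)
      ≡⟨ cong (λ t → t + (- p) * Σ[ n ] (λ y → A c y z) + fromℕ n * (p * p))
              (cong₂ _+_ (Σ-A*A c x z) (Σ-*ˡ n (- p) (λ y → A c x y))) ⟩
    fromℕ (redCodegree c x z) + (- p) * Σ[ n ] (λ y → A c x y) + (- p) * Σ[ n ] (λ y → A c y z)
      + fromℕ n * (p * p)
      ≡⟨ cong₂ (λ u v → fromℕ (redCodegree c x z) + (- p) * u + (- p) * v + fromℕ n * (p * p))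
               (Σ-A c x) (Σ-A-sym c z) ⟩
    fromℕ (redCodegree c x z) + (- p) * fromℕ (redDegree c x) + (- p) * fromℕ (redDegree c z)
      + fromℕ n * (p * p) ∎
    where
    open ≡-Reasoning
    expand : ∀ a b → (a − p) * (b − p) ≡ a * b + (- p) * a + (- p) * b + p * p
    expand a b = solve 3 (λ a b p → (a :- p) :* (b :- p) := a :* b :+ (:- p) :* a :+ (:- p) :* b :+ p :* p) refl a b p

module DegreeBounds (ℝ : Reals) where
  open import Data.Nat using (suc)
  open import Data.Sum using (inj₁; inj₂)
  open import Data.Empty using (⊥-elim)
  open import Relation.Binary.PropositionalEquality
  open OrderedField ℝ

  -- d < r ≤ F·B ≤ (1 + X) f*·B ≤ (1 + X) f*·D·W = (1 + X) N W
  ramsey-degree-bound : ∀ {d r : ℕ} {F B X W f* N D} →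
    suc d ℕ.≤ r → fromℕ r ≤ F * B → 0# < F → F / f* ≤ 1# + X →
    0# ≤ f* → f* ≢ 0# → f* * D ≡ N → 0# ≤ B → B ≤ D * W →
    fromℕ (suc d) ≤ (1# + X) * (N * W)
  ramsey-degree-bound {F = F} {B} {X} {W} {f*} {N} {D} d<r r≤FB (0≤F , 0≢F) F/f*≤1+X 0≤f* f*≢0 f*D≡N 0≤B B≤DW =
    ≤-trans (fromℕ-mono-≤ d<r) (≤-trans r≤FB (≤-trans FB≤ (≤-resp-≡ (sym (*-assoc _ _ _)) refl
      (*-monoʳ-≤-nonneg (1# + X) 0≤1+X f*B≤NW))))
    where
    F≤[1+X]f* : F ≤ (1# + X) * f*
    F≤[1+X]f* = ≤-resp-≡ (x/y*y≡x F f* f*≢0) refl (*-monoˡ-≤-nonneg f* 0≤f* F/f*≤1+X)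
    0≤1+X : 0# ≤ 1# + X
    0≤1+X with ≤-total 0# (1# + X)
    ... | inj₁ 0≤1+X = 0≤1+X
    ... | inj₂ 1+X≤0 = ⊥-elim (0≢F (≤-antisym 0≤F
            (≤-trans F≤[1+X]f* (≤-resp-≡ refl (zeroˡ f*) (*-monoˡ-≤-nonneg f* 0≤f* 1+X≤0)))))
    FB≤ : F * B ≤ ((1# + X) * f*) * B
    FB≤ = *-monoˡ-≤-nonneg B 0≤B F≤[1+X]f*
    f*B≤NW : f* * B ≤ N * W
    f*B≤NW = ≤-resp-≡ refl (trans (sym (*-assoc _ _ _)) (cong (_* W) f*D≡N)) (*-monoʳ-≤-nonneg f* 0≤f* B≤DW)

module Lemma3-1 (ℝ : Reals) (k l : ℕ) (γ δ : Reals.R ℝ) (f : ℕ → ℕ → Reals.R ℝ)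
  (f-pos : ∀ a b → Reals._<_ ℝ (Reals.0# ℝ) (f a b)) (2≤k : 2 ℕ.≤ k) (2≤l : 2 ℕ.≤ l) where
  open import Data.Nat using (suc; s≤s; z≤n)
  open import Data.Integer using () renaming (+_ to +ℤ_)
  open import Data.Bool using (true; false)
  open import Data.Fin.Properties using (nonZeroIndex)
  open import Data.Sum using (inj₁; inj₂)
  open import Relation.Binary.PropositionalEquality
  open Counting
  open Binomial
  open OrderedField ℝ
  open RealDefs ℝ
  open BalancedSums ℝ
  open DegreeBounds ℝ

  n : ℕ
  n = ∣ ⌊ f k l * fromℕ ((k ℕ.+ l) C k) ⌋ ∣

  N K L M S S² Cₖₗ f* p q : R
  N    = fromℕ n
  K    = fromℕ k
  L    = fromℕ l
  M    = fromℕ (k ⊔ l)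
  S    = fromℕ (k ℕ.+ l)
  S²   = fromℕ ((k ℕ.+ l) ^ 2)
  Cₖₗ  = fromℕ ((k ℕ.+ l) C k)
  f*   = N / Cₖₗ
  p    = K / S
  q    = L * S ⁻¹

  Hypotheses : Set
  Hypotheses = ∀ m → m ≡ 1 ⊎ m ≡ 2 →
      RamseyLE (k ℕ.+ 1 ∸ m) (l ℕ.+ 1) (f (k ∸ m) l * fromℕ (((k ∸ m) ℕ.+ l) C (k ∸ m)))
    × RamseyLE (k ℕ.+ 1) (l ℕ.+ 1 ∸ m) (f k (l ∸ m) * fromℕ (((k ℕ.+ l) ∸ m) C k))
    × f (k ∸ m) l / f* ≤ 1# + fromℕ m * γ
    × f k (l ∸ m) / f* ≤ 1# + fromℕ m * δ

  S*S⁻¹≡1 : S * S ⁻¹ ≡ 1#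
  S*S⁻¹≡1 = inverseʳ S (fromℕ-≢0 (ℕ.≤-trans (ℕ.≤-trans (s≤s z≤n) 2≤k) (ℕ.m≤m+n k l)))

  [K+L]*S⁻¹≡1 : (K + L) * S ⁻¹ ≡ 1#
  [K+L]*S⁻¹≡1 = trans (cong (_* S ⁻¹) (sym (fromℕ-+ k l))) S*S⁻¹≡1

  S²⁻¹≡S⁻¹*S⁻¹ : S² ⁻¹ ≡ S ⁻¹ * S ⁻¹
  S²⁻¹≡S⁻¹*S⁻¹ = sym (⁻¹-unique S² (S ⁻¹ * S ⁻¹) (begin
    S² * (S ⁻¹ * S ⁻¹)               ≡⟨ cong (_* (S ⁻¹ * S ⁻¹)) (trans (fromℕ-* (k ℕ.+ l) _) (cong (S *_) (fromℕ-* (k ℕ.+ l) 1))) ⟩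
    S * (S * fromℕ 1) * (S ⁻¹ * S ⁻¹) ≡⟨ solve 2 (λ S s → S :* (S :* (con (+ℤ 0) :+ con (+ℤ 1))) :* (s :* s) := (S :* s) :* (S :* s)) refl S (S ⁻¹) ⟩
    (S * S ⁻¹) * (S * S ⁻¹)          ≡⟨ cong (λ u → u * u) S*S⁻¹≡1 ⟩
    1# * 1#                          ≡⟨ *-identityʳ 1# ⟩
    1#                               ∎))
    where open ≡-Reasoning

  0≤S⁻¹ : 0# ≤ S ⁻¹
  0≤S⁻¹ = ⁻¹-nonneg (fromℕ-nonneg (k ℕ.+ l)) (x*y≡1⇒x≢0 S*S⁻¹≡1)

  0≤p : 0# ≤ p
  0≤p = *-nonneg (fromℕ-nonneg k) 0≤S⁻¹

  0≤q : 0# ≤ q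
  0≤q = *-nonneg (fromℕ-nonneg l) 0≤S⁻¹

  Cₖₗ≢0 : Cₖₗ ≢ 0#
  Cₖₗ≢0 = fromℕ-≢0 (0<[k+l]Ck k l)

  f*Cₖₗ≡N : f* * Cₖₗ ≡ N
  f*Cₖₗ≡N = x/y*y≡x N Cₖₗ Cₖₗ≢0

  0≤f* : 0# ≤ f*
  0≤f* = *-nonneg (fromℕ-nonneg n) (⁻¹-nonneg (fromℕ-nonneg ((k ℕ.+ l) C k)) Cₖₗ≢0)

  f*≢0 : Fin n → f* ≢ 0#
  f*≢0 x = x*y≡1⇒x≢0 {y = Cₖₗ * N ⁻¹}
    (trans (sym (*-assoc f* Cₖₗ _)) (trans (cong (_* N ⁻¹) f*Cₖₗ≡N) (inverseʳ N (fromℕ-≢0 (ℕ.>-nonZero⁻¹ n {{nonZeroIndex x}})))))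

  C[k∸1]≡Cₖₗ*p : fromℕ (((k ∸ 1) ℕ.+ l) C (k ∸ 1)) ≡ Cₖₗ * p
  C[k∸1]≡Cₖₗ*p = ≡-divide S*S⁻¹≡1 (trans (sym (fromℕ-* ((k ℕ.+ l) C k) k))
    (trans (cong fromℕ ([k+l]Ck*k≡[k∸1+l]C[k∸1]*[k+l] k l (ℕ.≤-trans (s≤s z≤n) 2≤k)))
           (fromℕ-* (((k ∸ 1) ℕ.+ l) C (k ∸ 1)) (k ℕ.+ l))))

  C[l∸1]≡Cₖₗ*q : fromℕ (((k ℕ.+ l) ∸ 1) C k) ≡ Cₖₗ * q
  C[l∸1]≡Cₖₗ*q = ≡-divide S*S⁻¹≡1 (trans (sym (fromℕ-* ((k ℕ.+ l) C k) l))
    (trans (cong fromℕ ([k+l]Ck*l≡[k+l∸1]Ck*[k+l] k l (ℕ.≤-trans (s≤s z≤n) 2≤l)))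
           (fromℕ-* (((k ℕ.+ l) ∸ 1) C k) (k ℕ.+ l))))

  C[k∸2]≤Cₖₗ*p² : fromℕ (((k ∸ 2) ℕ.+ l) C (k ∸ 2)) ≤ Cₖₗ * (p * p)
  C[k∸2]≤Cₖₗ*p² = ≤-divide² S*S⁻¹≡1 0≤S⁻¹ (≤-resp-≡ (fromℕ-*² c (k ℕ.+ l)) (fromℕ-*² ((k ℕ.+ l) C k) k)
    (fromℕ-mono-≤ {c ℕ.* ((k ℕ.+ l) ℕ.* (k ℕ.+ l))} ([k∸2+l]C[k∸2]*[k+l]²≤[k+l]Ck*k² k l 2≤k)))
    where
    c : ℕ
    c = ((k ∸ 2) ℕ.+ l) C (k ∸ 2)

  C[l∸2]≤Cₖₗ*q² : fromℕ (((k ℕ.+ l) ∸ 2) C k) ≤ Cₖₗ * (q * q)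
  C[l∸2]≤Cₖₗ*q² = ≤-divide² S*S⁻¹≡1 0≤S⁻¹ (≤-resp-≡ (fromℕ-*² c (k ℕ.+ l)) (fromℕ-*² ((k ℕ.+ l) C k) l)
    (fromℕ-mono-≤ {c ℕ.* ((k ℕ.+ l) ℕ.* (k ℕ.+ l))} ([k+l∸2]Ck*[k+l]²≤[k+l]Ck*l² k l 2≤l)))
    where
    c : ℕ
    c = ((k ℕ.+ l) ∸ 2) C k

  module ForColouring (H : Hypotheses) (c : Colouring n)
           (noRed : ¬ HasRedClique (k ℕ.+ 1) c) (noBlue : ¬ HasBlueClique (l ℕ.+ 1) c) where
    open NoCliques c noRed noBlue

    d b : Fin n → R
    d x = fromℕ (redDegree c x)
    b x = fromℕ (blueDegree c x)

    red-degree-bound : ∀ x → d x + 1# ≤ (1# + fromℕ 1 * γ) * (N * p)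
    red-degree-bound x with H 1 (inj₁ refl)
    ... | (r , (ramsey , _) , r≤) , _ , ratio , _ =
      ramsey-degree-bound (redDegree<ramsey ramsey (ℕ.m∸n+n≡m (ℕ.m≤n+m 1 k)) x) r≤ (f-pos _ _) ratio
        0≤f* (f*≢0 x) f*Cₖₗ≡N (fromℕ-nonneg (((k ∸ 1) ℕ.+ l) C (k ∸ 1))) (≤-reflexive C[k∸1]≡Cₖₗ*p)

    blue-degree-bound : ∀ x → b x + 1# ≤ (1# + fromℕ 1 * δ) * (N * q)
    blue-degree-bound x with H 1 (inj₁ refl)
    ... | _ , (r , (ramsey , _) , r≤) , _ , ratio =
      ramsey-degree-bound (blueDegree<ramsey ramsey (ℕ.m∸n+n≡m (ℕ.m≤n+m 1 l)) x) r≤ (f-pos _ _) ratio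
        0≤f* (f*≢0 x) f*Cₖₗ≡N (fromℕ-nonneg (((k ℕ.+ l) ∸ 1) C k)) (≤-reflexive C[l∸1]≡Cₖₗ*q)

    red-codegree-bound : ∀ x z → x ≢ z → colour c x z ≡ true →
      fromℕ (redCodegree c x z) + 1# ≤ (1# + fromℕ 2 * γ) * (N * (p * p))
    red-codegree-bound x z x≢z xz-red with H 2 (inj₂ refl)
    ... | (r , (ramsey , _) , r≤) , _ , ratio , _ =
      ramsey-degree-bound (redCodegree<ramsey ramsey (ℕ.m∸n+n≡m (ℕ.≤-trans 2≤k (ℕ.m≤m+n k 1))) x z x≢z xz-red)
        r≤ (f-pos _ _) ratio 0≤f* (f*≢0 x) f*Cₖₗ≡N (fromℕ-nonneg (((k ∸ 2) ℕ.+ l) C (k ∸ 2))) C[k∸2]≤Cₖₗ*p²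

    blue-codegree-bound : ∀ x z → x ≢ z → colour c x z ≡ false →
      fromℕ (blueCodegree c x z) + 1# ≤ (1# + fromℕ 2 * δ) * (N * (q * q))
    blue-codegree-bound x z x≢z xz-blue with H 2 (inj₂ refl)
    ... | _ , (r , (ramsey , _) , r≤) , _ , ratio =
      ramsey-degree-bound (blueCodegree<ramsey ramsey (ℕ.m∸n+n≡m (ℕ.≤-trans 2≤l (ℕ.m≤m+n l 1))) x z x≢z xz-blue)
        r≤ (f-pos _ _) ratio 0≤f* (f*≢0 x) f*Cₖₗ≡N (fromℕ-nonneg (((k ℕ.+ l) ∸ 2) C k)) C[l∸2]≤Cₖₗ*q²

    d+b+1≡N : ∀ x → d x + (b x + 1#) ≡ N
    d+b+1≡N x = trans (sym (fromℕ-+ (redDegree c x) (suc (blueDegree c x)))) (cong fromℕ (redDegree+blueDegree c x))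

    codegree-identity : ∀ x z → x ≢ z → colour c x z ≡ false →
      fromℕ (blueCodegree c x z) + fromℕ 2 + d x + d z ≡ N + fromℕ (redCodegree c x z)
    codegree-identity x z x≢z xz-blue = begin
      fromℕ (blueCodegree c x z) + fromℕ 2 + d x + d z
        ≡⟨ cong (λ t → t + d x + d z) (sym (fromℕ-+ (blueCodegree c x z) 2)) ⟩
      fromℕ (blueCodegree c x z ℕ.+ 2) + d x + d z
        ≡⟨ cong (_+ d z) (sym (fromℕ-+ (blueCodegree c x z ℕ.+ 2) (redDegree c x))) ⟩
      fromℕ (blueCodegree c x z ℕ.+ 2 ℕ.+ redDegree c x) + d z
        ≡⟨ sym (fromℕ-+ (blueCodegree c x z ℕ.+ 2 ℕ.+ redDegree c x) (redDegree c z)) ⟩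
      fromℕ (blueCodegree c x z ℕ.+ 2 ℕ.+ redDegree c x ℕ.+ redDegree c z)
        ≡⟨ cong fromℕ (blueCodegree+redDegrees c x z x≢z xz-blue) ⟩
      fromℕ (n ℕ.+ redCodegree c x z)
        ≡⟨ fromℕ-+ n (redCodegree c x z) ⟩
      N + fromℕ (redCodegree c x z) ∎
      where open ≡-Reasoning

    -- In the certificates, one′ and two are fromℕ 1 = 0# + 1# and fromℕ 2 = 0# + 1# + 1# unfolded.

    Σ-upper : ∀ x → Σ[ n ] (λ y → balanced c p x y) ≤ (K * γ / S) * N
    Σ-upper x = ≤-resp-≡ (sym (Σ-balanced c p x)) refl
      (≤-by-certificate (+-nonneg (x≤y⇒0≤y−x (red-degree-bound x)) 0≤1) refl refl refl refl
        (solve 5 (λ K γ s N d →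
          let p    = K :* s
              o    = con (+ℤ 1)
              one′ = con (+ℤ 0) :+ con (+ℤ 1)
              ∅    = con (+ℤ 0)
          in K :* γ :* s :* N :- (d :+ N :* (:- p))
             := (((o :+ one′ :* γ) :* (N :* p) :- (d :+ o)) :+ o)
                :+ ∅ :* (∅ :- ∅) :+ ∅ :* (∅ :- ∅) :+ ∅ :* (∅ :- ∅) :+ ∅ :* (∅ :- ∅))
          refl K γ (S ⁻¹) N (d x)))

    Σ-lower : ∀ x → - (L * δ / S) * N ≤ Σ[ n ] (λ y → balanced c p x y)
    Σ-lower x = ≤-resp-≡ refl (sym (Σ-balanced c p x))
      (≤-by-certificate (x≤y⇒0≤y−x (blue-degree-bound x)) (d+b+1≡N x) refl [K+L]*S⁻¹≡1 refl
        (solve 7 (λ K L δ s N d b →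
          let p    = K :* s
              q    = L :* s
              o    = con (+ℤ 1)
              one′ = con (+ℤ 0) :+ con (+ℤ 1)
              ∅    = con (+ℤ 0)
          in (d :+ N :* (:- p)) :- (:- (L :* δ :* s)) :* N
             := ((o :+ one′ :* δ) :* (N :* q) :- (b :+ o))
                :+ o :* ((d :+ (b :+ o)) :- N) :+ ∅ :* (∅ :- ∅)
                :+ (:- N) :* ((K :+ L) :* s :- o) :+ ∅ :* (∅ :- ∅))
          refl K L δ (S ⁻¹) N (d x) (b x)))

    0≤N*[Kγ+Lδ] : Fin n → 0# ≤ N * (K * γ + L * δ)
    0≤N*[Kγ+Lδ] x = ≤-resp-≡ refl (sym (≡-by-certificate [K+L]*S⁻¹≡1
        (solve 6 (λ K L γ δ s N →
          let o = con (+ℤ 1)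
              W = K :* γ :+ L :* δ
          in N :* W := (K :+ L) :* (K :* γ :* s :* N :- (:- (L :* δ :* s)) :* N)
                       :+ (:- (N :* W)) :* ((K :+ L) :* s :- o))
          refl K L γ δ (S ⁻¹) N)))
      (*-nonneg (+-nonneg (fromℕ-nonneg k) (fromℕ-nonneg l)) (x≤y⇒0≤y−x (≤-trans (Σ-lower x) (Σ-upper x))))

    bound : R
    bound = fromℕ 2 * (M / S²) * (K * γ + L * δ) * N + 1#

    Σ-product-red : ∀ x z → x ≢ z → colour c x z ≡ true →
      Σ[ n ] (λ y → balanced c p x y * balanced c p y z) ≤ bound
    Σ-product-red x z x≢z xz-red = ≤-resp-≡ (sym (Σ-balanced-product c p x z)) refl
      (≤-by-certificate
        (+-nonneg (+-nonneg (+-nonneg (+-nonneg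
          (x≤y⇒0≤y−x (red-codegree-bound x z x≢z xz-red))
          (*-nonneg 0≤p (x≤y⇒0≤y−x (blue-degree-bound x))))
          (*-nonneg 0≤p (x≤y⇒0≤y−x (blue-degree-bound z))))
          (*-nonneg (*-nonneg (*-nonneg (fromℕ-nonneg 2) (*-nonneg 0≤S⁻¹ 0≤S⁻¹))
                              (x≤y⇒0≤y−x (fromℕ-mono-≤ (ℕ.m≤m⊔n k l)))) (0≤N*[Kγ+Lδ] x)))
          (+-nonneg 0≤1 0≤1))
        (d+b+1≡N x) (d+b+1≡N z) [K+L]*S⁻¹≡1 S²⁻¹≡S⁻¹*S⁻¹
        (solve 13 (λ M S²⁻¹ K γ L δ N cr dx dz bx bz s →
          let p    = K :* s
              q    = L :* s
              two  = con (+ℤ 0) :+ con (+ℤ 1) :+ con (+ℤ 1)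
              one′ = con (+ℤ 0) :+ con (+ℤ 1)
              o    = con (+ℤ 1)
              W    = K :* γ :+ L :* δ
          in (two :* (M :* S²⁻¹) :* W :* N :+ o) :- (cr :+ (:- p) :* dx :+ (:- p) :* dz :+ N :* (p :* p))
             := ((o :+ two :* γ) :* (N :* (p :* p)) :- (cr :+ o))
                :+ p :* ((o :+ one′ :* δ) :* (N :* q) :- (bx :+ o))
                :+ p :* ((o :+ one′ :* δ) :* (N :* q) :- (bz :+ o))
                :+ two :* (s :* s) :* (M :- K) :* (N :* W)
                :+ (o :+ o)
                :+ p :* ((dx :+ (bx :+ o)) :- N)
                :+ p :* ((dz :+ (bz :+ o)) :- N)
                :+ (:- (two :* p :* N)) :* ((K :+ L) :* s :- o)
                :+ (two :* M :* N :* W) :* (S²⁻¹ :- s :* s))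
          refl M (S² ⁻¹) K γ L δ N (fromℕ (redCodegree c x z)) (d x) (d z) (b x) (b z) (S ⁻¹)))

    Σ-product-blue : ∀ x z → x ≢ z → colour c x z ≡ false →
      Σ[ n ] (λ y → balanced c p x y * balanced c p y z) ≤ bound
    Σ-product-blue x z x≢z xz-blue = ≤-resp-≡ (sym (Σ-balanced-product c p x z)) refl
      (≤-by-certificate
        (+-nonneg (+-nonneg (+-nonneg (+-nonneg
          (x≤y⇒0≤y−x (blue-codegree-bound x z x≢z xz-blue))
          (*-nonneg 0≤q (x≤y⇒0≤y−x (red-degree-bound x))))
          (*-nonneg 0≤q (x≤y⇒0≤y−x (red-degree-bound z))))
          (*-nonneg (*-nonneg (*-nonneg (fromℕ-nonneg 2) (*-nonneg 0≤S⁻¹ 0≤S⁻¹))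
                              (x≤y⇒0≤y−x (fromℕ-mono-≤ (ℕ.m≤n⊔m k l)))) (0≤N*[Kγ+Lδ] x)))
          (*-nonneg (fromℕ-nonneg 2) 0≤q))
        (codegree-identity x z x≢z xz-blue) [K+L]*S⁻¹≡1 S²⁻¹≡S⁻¹*S⁻¹ refl
        (solve 12 (λ M S²⁻¹ K γ L δ N cr cb dx dz s →
          let p    = K :* s
              q    = L :* s
              two  = con (+ℤ 0) :+ con (+ℤ 1) :+ con (+ℤ 1)
              one′ = con (+ℤ 0) :+ con (+ℤ 1)
              o    = con (+ℤ 1)
              ∅    = con (+ℤ 0)
              W    = K :* γ :+ L :* δ
          in (two :* (M :* S²⁻¹) :* W :* N :+ o) :- (cr :+ (:- p) :* dx :+ (:- p) :* dz :+ N :* (p :* p))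
             := ((o :+ two :* δ) :* (N :* (q :* q)) :- (cb :+ o))
                :+ q :* ((o :+ one′ :* γ) :* (N :* p) :- (dx :+ o))
                :+ q :* ((o :+ one′ :* γ) :* (N :* p) :- (dz :+ o))
                :+ two :* (s :* s) :* (M :- L) :* (N :* W)
                :+ two :* q
                :+ o :* ((cb :+ two :+ dx :+ dz) :- (N :+ cr))
                :+ (dx :+ dz :- N :* (p :+ q :+ o)) :* ((K :+ L) :* s :- o)
                :+ (two :* M :* N :* W) :* (S²⁻¹ :- s :* s)
                :+ ∅ :* (∅ :- ∅))
          refl M (S² ⁻¹) K γ L δ N (fromℕ (redCodegree c x z)) (fromℕ (blueCodegree c x z)) (d x) (d z) (S ⁻¹)))

    Σ-product-bound : ∀ x z → x ≢ z → Σ[ n ] (λ y → balanced c p x y * balanced c p y z) ≤ bound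
    Σ-product-bound x z x≢z with colour c x z in xz
    ... | true  = Σ-product-red x z x≢z xz
    ... | false = Σ-product-blue x z x≢z xz

lemma3p1 : (ℝ : Reals) → let open Reals ℝ in let open RealDefs ℝ in
  (k l : ℕ) (γ δ : R) (f : ℕ → ℕ → R) →
  (∀ a b → 0# < f a b) →
  2 N.≤ k → 2 N.≤ l →
  let n     = ∣ ⌊ f k l * fromℕ ((k N.+ l) C k) ⌋ ∣
      fstar = fromℕ n / fromℕ ((k N.+ l) C k)
  in
  (∀ m → m ≡ 1 ⊎ m ≡ 2 →
     RamseyLE (k N.+ 1 ∸ m) (l N.+ 1)
       (f (k ∸ m) l * fromℕ (((k ∸ m) N.+ l) C (k ∸ m)))
   × RamseyLE (k N.+ 1) (l N.+ 1 ∸ m)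
       (f k (l ∸ m) * fromℕ (((k N.+ l) ∸ m) C k))
   × f (k ∸ m) l / fstar ≤ 1# + fromℕ m * γ
   × f k (l ∸ m) / fstar ≤ 1# + fromℕ m * δ) →
  (c : Colouring n) →
  ¬ HasRedClique (k N.+ 1) c →
  ¬ HasBlueClique (l N.+ 1) c →
  let p = fromℕ k / fromℕ (k N.+ l)
      g = balanced c p
  in
  (∀ (x : Fin n) →
      (- (fromℕ l * δ / fromℕ (k N.+ l)) * fromℕ n ≤ Σ[ n ] (λ y → g x y))
    × (Σ[ n ] (λ y → g x y) ≤ (fromℕ k * γ / fromℕ (k N.+ l)) * fromℕ n))
  × (∀ (x z : Fin n) → x ≢ z →
      Σ[ n ] (λ y → g x y * g y z)
        ≤ fromℕ 2 * (fromℕ (k ⊔ l) / fromℕ ((k N.+ l) ^ 2))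
             * (fromℕ k * γ + fromℕ l * δ) * fromℕ n + 1#)
lemma3p1 ℝ k l γ δ f f-pos 2≤k 2≤l H c noRed noBlue =
  (λ x → Σ-lower x , Σ-upper x) , Σ-product-bound
  where
  open Lemma3-1 ℝ k l γ δ f f-pos 2≤k 2≤l
  open ForColouring H c noRed noBlue
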